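{- Let $G$ be a finite simple graph with $V(G)=[n]$, let $\gamma$ be any choice function for $G$, and let $f$ be a $G$-multiparking function. Then every tree component $T$ of the spanning forest $\Phi_{\gamma,G}(f)$ contains exactly one vertex $v$ with $f(v)=\infty$, and this vertex $v$ is the least vertex (in the integer order) of $T$.
   Context: $G$ is a finite simple graph with vertex set $V(G)=[n]=\{1,\dots,n\}$, ordered as integers, and edge set $E(G)$. For $U\subseteq V(G)$ and $v\in U$, $\mathrm{outdeg}_U(v)$ is the number of edges $\{v,w\}\in E(G)$ with $w\notin U$. A $G$-multiparking function is a function $f:[n]\to\mathbb{N}\cup\{\infty\}$ (with $\mathbb N=\{0,1,2,\dots\}$) such that for every nonempty $U\subseteq[n]$, either (A) the smallest vertex $i=\min U$ satisfies $f(i)=\infty$, or (B) there is $i\in U$ with $0\le f(i)<\mathrm{outdeg}_U(i)$. A subforest of $G$ is a subgraph of $G$ (not necessarily containing all vertices) without cycles; $\mathrm{Leaf}(F)$ is the set of vertices of degree $1$ in $F$. A choice function $\gamma$ assigns to each pair $(F,W)$, where $F$ is a subforest of $G$ and $W$ is either a nonempty subset of $\mathrm{Leaf}(F)$ or a set consisting of one isolated vertex of $F$, an element $\gamma(F,W)\in W$. Algorithm A (defining $\Phi_{\gamma,G}$). Given a $G$-multiparking function $f$, set $val_0=f$, $P_0=\emptyset$, $Q_0=\{1\}$, and $F_0$ the graph with the single vertex $1$ and no edges. For $i=1,\dots,n$: let $v=\gamma(F_{i-1},Q_{i-1})$. For every neighbor $w$ of $v$ in $G$ with $w\notin P_{i-1}$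 set $val_i(w)=val_{i-1}(w)-1$ (with $\infty-1=\infty$); for all other vertices $u$ set $val_i(u)=val_{i-1}(u)$. Let $N=\{w: val_i(w)=-1,\ val_{i-1}(w)\neq -1\}$. Set $P_i=P_{i-1}\cup\{v\}$; set $Q_i=(Q_{i-1}\cup N)\setminus\{v\}$ if this set is nonempty, and otherwise $Q_i=\{u\}$ with $u$ the smallest vertex of $[n]\setminus P_i$ (and $Q_i=\emptyset$ if $P_i=[n]$). Let $F_i$ be the graph on $P_i\cup Q_i$ whose edges are those of $F_{i-1}$ together with $\{w,v\}$ for each $w\in N$. Then $\Phi_{\gamma,G}(f):=F_n$, a spanning forest of $G$. -}

module Defs where

open import Data.Nat using (ℕ; zero; suc; _<_)
open import Data.Integer using (ℤ; -[1+_]; +_; _-_; 1ℤ)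
open import Data.Bool using (Bool; true; false; _∧_; _∨_; not; if_then_else_)
open import Data.Fin using (Fin; zero; suc; _≤_; _≟_)
open import Data.Fin.Subset using (Subset; _∈_; _∉_; _⊆_; ∁; _∩_; _∪_; _─_; ⁅_⁆; ∣_∣; Nonempty; ⊥)
open import Data.Vec using (Vec; []; _∷_; lookup; tabulate; foldr)
open import Data.Maybe using (Maybe; just; nothing)
import Data.Maybe as Maybe
open import Data.List using (List; []; _∷_; _++_; [_]; length)
open import Data.List.Relation.Unary.Linked using (Linked)
open import Data.List.Relation.Unary.Unique.Propositional using (Unique)
open import Data.Product using (Σ; ∃; ∃-syntax; _×_; _,_)
open import Data.Sum using (_⊎_)
open import Relation.Binary.PropositionalEquality using (_≡_)
open import Relation.Nullary.Decidable using (⌊_⌋)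

-- Vertex set [n] is represented by Fin n, with vertex i+1 ↦ i (order preserved).
-- ℕ ∪ {∞} is represented by Maybe ℕ with nothing = ∞.
ℕ∞ : Set
ℕ∞ = Maybe ℕ

∞ : ℕ∞
∞ = nothing

record SimpleGraph (n : ℕ) : Set where
  field
    adj   : Vec (Subset n) n
    sym   : ∀ u w → w ∈ lookup adj u → u ∈ lookup adj w
    irrefl : ∀ u → u ∉ lookup adj u
open SimpleGraph public

Edge : ∀ {n} → SimpleGraph n → Fin n → Fin n → Set
Edge G u w = w ∈ lookup (adj G) u

outdeg : ∀ {n} → SimpleGraph n → Subset n → Fin n → ℕ
outdeg G U v = ∣ lookup (adj G) v ∩ ∁ U ∣

IsMinOf : ∀ {n} → Subset n → Fin n → Set
IsMinOf U i = i ∈ U × (∀ j → j ∈ U → i ≤ j)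

IsMultiparking : ∀ {n} → SimpleGraph n → (Fin n → ℕ∞) → Set
IsMultiparking {n} G f =
  ∀ (U : Subset n) → Nonempty U →
    (∃[ i ] (IsMinOf U i × f i ≡ ∞))
    ⊎ (∃[ i ] (i ∈ U × ∃[ k ] (f i ≡ just k × k < outdeg G U i)))

record Subgraph (n : ℕ) : Set where
  constructor mkSubgraph
  field
    verts : Subset n
    edges : Vec (Subset n) n
open Subgraph public

Adj : ∀ {n} → Subgraph n → Fin n → Fin n → Set
Adj F u w = w ∈ lookup (edges F) u

IsSubgraphOf : ∀ {n} → Subgraph n → SimpleGraph n → Set
IsSubgraphOf F G =
  ∀ u w → Adj F u w → (u ∈ verts F × w ∈ verts F × Adj F w u × Edge G u w)

HasCycle : ∀ {n} → Subgraph n → Set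
HasCycle {n} F =
  ∃[ x ] ∃[ xs ] (2 Data.Nat.≤ length xs × Unique (x ∷ xs)
                  × Linked (Adj F) (x ∷ xs ++ [ x ]))

IsSubforestOf : ∀ {n} → Subgraph n → SimpleGraph n → Set
IsSubforestOf F G = IsSubgraphOf F G × (HasCycle F → Data.Empty.⊥)
  where import Data.Empty

degF : ∀ {n} → Subgraph n → Fin n → ℕ
degF F v = ∣ lookup (edges F) v ∣

IsLeaf : ∀ {n} → Subgraph n → Fin n → Set
IsLeaf F v = v ∈ verts F × degF F v ≡ 1

IsIsolated : ∀ {n} → Subgraph n → Fin n → Set
IsIsolated F v = v ∈ verts F × degF F v ≡ 0

AdmissibleW : ∀ {n} → Subgraph n → Subset n → Set
AdmissibleW F W =
  (Nonempty W × (∀ v → v ∈ W → IsLeaf F v))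
  ⊎ (∃[ v ] (IsIsolated F v × W ≡ ⁅ v ⁆))

-- choice function γ for G: γ(F,W) ∈ W for every subforest F and admissible W
-- (values on other pairs are irrelevant)
IsChoiceFunction : ∀ {n} → SimpleGraph n → (Subgraph n → Subset n → Fin n) → Set
IsChoiceFunction G γ =
  ∀ F W → IsSubforestOf F G → AdmissibleW F W → γ F W ∈ W

anyB : ∀ {n} → Vec Bool n → Bool
anyB = foldr _ _∨_ false

firstOutside : ∀ {n} → Subset n → Maybe (Fin n)
firstOutside []           = nothing
firstOutside (false ∷ p)  = just zero
firstOutside (true ∷ p)   = Maybe.map suc (firstOutside p)

restart : ∀ {n} → Subset n → Subset n
restart P with firstOutside P
... | just u  = ⁅ u ⁆
... | nothing = ⊥

isMinusOne : Maybe ℤ → Bool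
isMinusOne (just -[1+ 0 ]) = true
isMinusOne _               = false

decr : Maybe ℤ → Maybe ℤ
decr = Maybe.map (λ z → z - 1ℤ)

eqB : ∀ {n} → Fin n → Fin n → Bool
eqB u w = ⌊ u ≟ w ⌋

record State (n : ℕ) : Set where
  constructor st
  field
    val : Fin n → Maybe ℤ
    P   : Subset n
    Q   : Subset n
    F   : Subgraph n
open State public

initState : ∀ {n} → (Fin n → ℕ∞) → State n
initState f = st (λ w → Maybe.map +_ (f w)) ⊥ Q₀ (mkSubgraph Q₀ (tabulate (λ _ → ⊥)))
  where Q₀ = restart ⊥

step : ∀ {n} → SimpleGraph n → (Subgraph n → Subset n → Fin n) → State n → State n
step {n} G γ (st val P Q F) = st val' P' Q' F'
  where
    v : Fin n
    v = γ F Q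
    hit : Fin n → Bool
    hit w = lookup (lookup (adj G) v) w ∧ not (lookup P w)
    val' : Fin n → Maybe ℤ
    val' w = if hit w then decr (val w) else val w
    N : Subset n
    N = tabulate (λ w → isMinusOne (val' w) ∧ not (isMinusOne (val w)))
    P' : Subset n
    P' = P ∪ ⁅ v ⁆
    Q₁ : Subset n
    Q₁ = (Q ∪ N) ─ ⁅ v ⁆
    Q' : Subset n
    Q' = if anyB Q₁ then Q₁ else restart P'
    F' : Subgraph n
    F' = mkSubgraph (P' ∪ Q')
           (tabulate (λ u → tabulate (λ w →
              lookup (lookup (edges F) u) w
              ∨ (eqB u v ∧ lookup N w)
              ∨ (eqB w v ∧ lookup N u))))

iterate : ∀ {A : Set} → ℕ → (A → A) → A → A
iterate zero    g a = a
iterate (suc k) g a = iterate k g (g a)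

Φ : ∀ {n} → SimpleGraph n → (Subgraph n → Subset n → Fin n) → (Fin n → ℕ∞) → Subgraph n
Φ {n} G γ f = F (iterate n (step G γ) (initState f))

data Reach {n} (F : Subgraph n) : Fin n → Fin n → Set where
  here  : ∀ {x} → Reach F x x
  there : ∀ {x y z} → Adj F x y → Reach F y z → Reach F x z

-- Algorithm A grows Φ one tree at a time, starting a tree at the least unprocessed vertex u
-- whenever the queue is empty.  At that moment every unprocessed w with f w finite has
-- f w ≥ outdeg_U w for the set U of unprocessed vertices (otherwise its counter would be
-- negative and w queued), so (B) fails for U and (A) gives f u = ∞.  Afterwards a vertex w
-- joins the tree only when its counter f w − #(processed neighbours) reaches −1, so f w is
-- finite, and u ≤ w because w was unprocessed when the tree was started.
-- For γ to choose from the queue, F must stay a forest and the queue a set of leaves or one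
-- isolated vertex.  Acyclicity holds because, ranking vertices by the step at which they
-- join, every vertex has at most one neighbour of smaller rank.

module Submission where

open import Defs renaming (sym to adj-sym)
open import Data.Nat using (ℕ; zero; suc; _<_; _+_; s≤s; z≤n)
import Data.Nat as ℕ
import Data.Nat.Properties as ℕ
open import Data.Integer using (ℤ; +_; _⊖_)
open import Data.Integer.Properties using (distribˡ-⊖-+-neg; [1+m]⊖[1+n]≡m⊖n; n⊖n≡0)
open import Data.Bool using (Bool; true; false; _∧_; _∨_; not; if_then_else_)
open import Data.Bool.Properties using (∧-zeroʳ; ∧-identityʳ; ∨-zeroʳ; ∨-identityʳ; ¬-not; not-injective)
open import Data.Fin using (Fin; zero; suc; _≤_; _≟_)
import Data.Fin.Properties as Fin
open import Data.Fin.Subset using (Subset; _∈_; ∁; _∩_; _∪_; _─_; ⁅_⁆; ∣_∣; Nonempty; ⊥; ⊤)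
open import Data.Fin.Subset.Properties
  using (∪-identityʳ; x∈⁅x⁆; x≢y⇒x∉⁅y⁆; x∈⁅y⁆⇒x≡y; ∣⁅x⁆∣≡1; ∣⊥∣≡0; ∣⊤∣≡n; ∣p∣≡n⇒p≡⊤; ∈⊤;
         Empty-unique)
open import Data.Vec using (Vec; []; _∷_; here; there; lookup; tabulate)
open import Data.Vec.Properties
  using ([]=⇒lookup; lookup⇒[]=; tabulate∘lookup; tabulate-cong; lookup∘tabulate; lookup-zipWith;
         lookup-map; lookup-replicate)
open import Data.Maybe using (Maybe; just; nothing)
import Data.Maybe as Maybe
open import Data.Maybe.Properties using (just-injective)
open import Data.List using (List; []; _∷_; _++_; [_]; length)
open import Data.List.Relation.Unary.Linked using (Linked; _∷_)
open import Data.List.Relation.Unary.All using (All; _∷_)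
open import Data.List.Relation.Unary.AllPairs using (_∷_)
open import Data.List.Relation.Unary.Unique.Propositional using (Unique)
open import Data.Product using (∃-syntax; _×_; _,_; proj₁; proj₂)
open import Data.Sum using (_⊎_; inj₁; inj₂)
import Data.Unit as Unit
open import Data.Empty using () renaming (⊥ to False; ⊥-elim to False-elim)
open import Function using (case_of_)
open import Relation.Nullary using (¬_; contradiction; yes; no)
open import Relation.Binary.Definitions using (Tri; tri<; tri≈; tri>)
open import Relation.Binary.PropositionalEquality
  using (_≡_; _≢_; refl; sym; trans; cong; cong₂; subst; subst₂; module ≡-Reasoning)

private
  variable
    n : ℕ

≡true⇒≢false : ∀ {b} → b ≡ true → b ≢ false
≡true⇒≢false refl ()

∞≢just : ∀ {k} → ∞ ≢ just k
∞≢just ()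

∨-true⁻ : ∀ a b → a ∨ b ≡ true → a ≡ true ⊎ b ≡ true
∨-true⁻ true  b e = inj₁ refl
∨-true⁻ false b e = inj₂ e

∨-false⁻ : ∀ a b → a ∨ b ≡ false → a ≡ false × b ≡ false
∨-false⁻ false false e = refl , refl

∧-not-true⁻ : ∀ a b → a ∧ not b ≡ true → a ≡ true × b ≡ false
∧-not-true⁻ true false e = refl , refl

-- Forests from rankings

-- On a cycle, a vertex of maximal rank would have two distinct lower neighbours.  Without
-- symmetry of R this is argued along the closed walk: once it rises it keeps rising.
module UniqueLowerNeighbour {A : Set} (R : A → A → Set) (rank : A → ℕ)
  (rank-≢ : ∀ {x y} → R x y → rank x ≢ rank y)
  (lower-unique : ∀ {a b c} → R a b → R b c → rank a < rank b → rank c < rank b → a ≡ c) where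

  NonBacktracking : List A → Set
  NonBacktracking (a ∷ b ∷ c ∷ cs) = a ≢ c × NonBacktracking (b ∷ c ∷ cs)
  NonBacktracking _ = Unit.⊤

  lastStep : A → A → List A → A × A
  lastStep a b []       = a , b
  lastStep a b (c ∷ cs) = lastStep b c cs

  lastStep-∷ʳ : ∀ a b cs z → proj₂ (lastStep a b (cs ++ [ z ])) ≡ z
  lastStep-∷ʳ a b []       z = refl
  lastStep-∷ʳ a b (c ∷ cs) z = lastStep-∷ʳ b c cs z

  ascent-persists : ∀ a b cs → Linked R (a ∷ b ∷ cs) → NonBacktracking (a ∷ b ∷ cs) → rank a < rank b →
    rank a < rank (proj₂ (lastStep a b cs)) × rank (proj₁ (lastStep a b cs)) < rank (proj₂ (lastStep a b cs))
  ascent-persists a b []       _                    _           a<b = a<b , a<b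
  ascent-persists a b (c ∷ cs) (Rab ∷ walk@(Rbc ∷ _)) (a≢c , nb) a<b with ℕ.<-cmp (rank b) (rank c)
  ... | tri< b<c _ _ = let a<z , y<z = ascent-persists b c cs walk nb b<c in ℕ.<-trans a<b a<z , y<z
  ... | tri≈ _ b≡c _ = False-elim (rank-≢ Rbc b≡c)
  ... | tri> _ _ c<b = False-elim (a≢c (lower-unique Rab Rbc a<b c<b))

  final-descent-ends-below-start : ∀ a b cs → Linked R (a ∷ b ∷ cs) → NonBacktracking (a ∷ b ∷ cs) →
    rank (proj₂ (lastStep a b cs)) < rank (proj₁ (lastStep a b cs)) → rank (proj₂ (lastStep a b cs)) < rank a
  final-descent-ends-below-start a b []       _                 _  z<y = z<y
  final-descent-ends-below-start a b (c ∷ cs) walk@(Rab ∷ walk′) nb@(_ , nb′) z<y with ℕ.<-cmp (rank a) (rank b)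
  ... | tri< a<b _ _ = False-elim (ℕ.<-asym z<y (proj₂ (ascent-persists a b (c ∷ cs) walk nb a<b)))
  ... | tri≈ _ a≡b _ = False-elim (rank-≢ Rab a≡b)
  ... | tri> _ _ b<a = ℕ.<-trans (final-descent-ends-below-start b c cs walk′ nb′ z<y) b<a

  lastStep-linked : ∀ a b cs → Linked R (a ∷ b ∷ cs) → R (proj₁ (lastStep a b cs)) (proj₂ (lastStep a b cs))
  lastStep-linked a b []       (Rab ∷ _)    = Rab
  lastStep-linked a b (c ∷ cs) (_ ∷ walk) = lastStep-linked b c cs walk

  All-penultimate : ∀ {P : A → Set} a b cs z → All P (b ∷ cs) → P (proj₁ (lastStep a b (cs ++ [ z ])))
  All-penultimate a b []       z (pb ∷ _)  = pb
  All-penultimate a b (c ∷ cs) z (_ ∷ ps) = All-penultimate b c cs z ps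

  nonBacktracking-∷ʳ : ∀ a b cs z → Unique (a ∷ b ∷ cs) → All (z ≢_) (a ∷ b ∷ cs) →
    NonBacktracking (a ∷ b ∷ cs ++ [ z ])
  nonBacktracking-∷ʳ a b []       z _                      (z≢a ∷ _)  = (λ a≡z → z≢a (sym a≡z)) , Unit.tt
  nonBacktracking-∷ʳ a b (c ∷ cs) z ((_ ∷ a≢c ∷ _) ∷ uq) (_ ∷ z≢) =
    a≢c , nonBacktracking-∷ʳ b c cs z uq z≢

  no-cycle : ∀ x xs → 2 ℕ.≤ length xs → Unique (x ∷ xs) → Linked R (x ∷ xs ++ [ x ]) → False
  no-cycle x []               ()
  no-cycle x (_ ∷ [])          (s≤s ())
  no-cycle x (a₁ ∷ a₂ ∷ rest) _ (x∉@(_ ∷ x≢a₂ ∷ _) ∷ uq′@(a₁∉ ∷ _)) walk@(Rxa₁ ∷ walk′) =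
    by-first-step (ℕ.<-cmp (rank x) (rank a₁))
    where
      nb : NonBacktracking (x ∷ a₁ ∷ a₂ ∷ rest ++ [ x ])
      nb = x≢a₂ , nonBacktracking-∷ʳ a₁ a₂ rest x uq′ x∉

      p : A
      p = proj₁ (lastStep x a₁ (a₂ ∷ rest ++ [ x ]))

      end≡x : proj₂ (lastStep x a₁ (a₂ ∷ rest ++ [ x ])) ≡ x
      end≡x = lastStep-∷ʳ x a₁ (a₂ ∷ rest) x

      Rpx : R p x
      Rpx = subst (R p) end≡x (lastStep-linked x a₁ (a₂ ∷ rest ++ [ x ]) walk)

      by-last-step : rank a₁ < rank x → Tri (rank p < rank x) (rank p ≡ rank x) (rank x < rank p) → False
      by-last-step a₁<x (tri< p<x _ _) =
        All-penultimate a₁ a₂ rest x a₁∉ (sym (lower-unique Rpx Rxa₁ p<x a₁<x))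
      by-last-step a₁<x (tri≈ _ p≡x _) = rank-≢ Rpx p≡x
      by-last-step a₁<x (tri> _ _ x<p) = ℕ.<-irrefl refl (subst (λ e → rank e < rank x) end≡x
        (final-descent-ends-below-start x a₁ (a₂ ∷ rest ++ [ x ]) walk nb
          (subst (λ e → rank e < rank p) (sym end≡x) x<p)))

      by-first-step : Tri (rank x < rank a₁) (rank x ≡ rank a₁) (rank a₁ < rank x) → False
      by-first-step (tri< x<a₁ _ _) = ℕ.<-irrefl refl (subst (λ e → rank x < rank e) end≡x
        (proj₁ (ascent-persists x a₁ (a₂ ∷ rest ++ [ x ]) walk nb x<a₁)))
      by-first-step (tri≈ _ x≡a₁ _) = rank-≢ Rxa₁ x≡a₁
      by-first-step (tri> _ _ a₁<x) = by-last-step a₁<x (ℕ.<-cmp (rank p) (rank x))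

record LowerNeighbourRanking {n} (F : Subgraph n) : Set where
  field
    rank         : Fin n → ℕ
    bound        : ℕ
    rank<bound   : ∀ x → rank x < bound
    rank-≢       : ∀ {x y} → Adj F x y → rank x ≢ rank y
    lower-unique : ∀ {a b c} → Adj F a b → Adj F b c → rank a < rank b → rank c < rank b → a ≡ c

ranked⇒acyclic : ∀ {n} {F : Subgraph n} → LowerNeighbourRanking F → HasCycle F → False
ranked⇒acyclic {F = F} ranking (x , xs , 2≤∣xs∣ , unique , closed) = no-cycle x xs 2≤∣xs∣ unique closed
  where
    open LowerNeighbourRanking ranking
    open UniqueLowerNeighbour (Adj F) rank rank-≢ lower-unique

Reach-preserves : ∀ {n} {A : Set} {F : Subgraph n} (g : Fin n → A) → (∀ {x y} → Adj F x y → g x ≡ g y) →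
  ∀ {x y} → Reach F x y → g x ≡ g y
Reach-preserves g g-adj here           = refl
Reach-preserves g g-adj (there xy y⇝z) = trans (g-adj xy) (Reach-preserves g g-adj y⇝z)

module AttachLeaves {n} {F F′ : Subgraph n} (v : Fin n) (new : Fin n → Bool)
  (adj-cases : ∀ {x y} → Adj F′ x y → Adj F x y ⊎ (x ≡ v × new y ≡ true) ⊎ (y ≡ v × new x ≡ true))
  (adj-old : ∀ {x y} → Adj F x y → new x ≡ false × new y ≡ false)
  (v-old : new v ≡ false) where

  along-new : ∀ {A : Set} → (Fin n → A) → A → Fin n → A
  along-new g a x = if new x then a else g x

  along-new-new : ∀ {A : Set} (g : Fin n → A) a {x} → new x ≡ true → along-new g a x ≡ a
  along-new-new g a e rewrite e = refl

  along-new-old : ∀ {A : Set} (g : Fin n → A) a {x} → new x ≡ false → along-new g a x ≡ g x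
  along-new-old g a e rewrite e = refl

  only-v-next-to-new : ∀ {a b} → Adj F′ a b → new b ≡ true → a ≡ v
  only-v-next-to-new h nb with adj-cases h
  ... | inj₁ old              = False-elim (≡true⇒≢false nb (proj₂ (adj-old old)))
  ... | inj₂ (inj₁ (a≡v , _)) = a≡v
  ... | inj₂ (inj₂ (refl , _)) = False-elim (≡true⇒≢false nb v-old)

  new-only-next-to-v : ∀ {b c} → Adj F′ b c → new b ≡ true → c ≡ v
  new-only-next-to-v h nb with adj-cases h
  ... | inj₁ old              = False-elim (≡true⇒≢false nb (proj₁ (adj-old old)))
  ... | inj₂ (inj₁ (refl , _)) = False-elim (≡true⇒≢false nb v-old)
  ... | inj₂ (inj₂ (c≡v , _)) = c≡v

  along-new-respects-Adj : ∀ {A : Set} (g : Fin n → A) → (∀ {x y} → Adj F x y → g x ≡ g y) →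
    ∀ {x y} → Adj F′ x y → along-new g (g v) x ≡ along-new g (g v) y
  along-new-respects-Adj g g-adj h with adj-cases h
  ... | inj₁ old = trans (along-new-old g (g v) (proj₁ (adj-old old)))
                     (trans (g-adj old) (sym (along-new-old g (g v) (proj₂ (adj-old old)))))
  ... | inj₂ (inj₁ (refl , ny)) = trans (along-new-old g (g v) v-old) (sym (along-new-new g (g v) ny))
  ... | inj₂ (inj₂ (refl , nx)) = trans (along-new-new g (g v) nx) (sym (along-new-old g (g v) v-old))

  attach-ranking : LowerNeighbourRanking F → LowerNeighbourRanking F′
  attach-ranking ranking = record
    { rank = rank′ ; bound = suc bound ; rank<bound = rank′<bound
    ; rank-≢ = rank′-≢ ; lower-unique = lower-unique′ }
    where
      open LowerNeighbourRanking ranking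
      rank′ : Fin n → ℕ
      rank′ = along-new rank bound

      v<new : ∀ {x} → new x ≡ true → rank′ v < rank′ x
      v<new e rewrite along-new-new rank bound e | along-new-old rank bound v-old = rank<bound v

      rank′<bound : ∀ x → rank′ x < suc bound
      rank′<bound x with new x
      ... | true  = ℕ.n<1+n bound
      ... | false = ℕ.m<n⇒m<1+n (rank<bound x)

      rank′-old : ∀ {x y} → Adj F x y → rank′ x ≡ rank x × rank′ y ≡ rank y
      rank′-old h = along-new-old rank bound (proj₁ (adj-old h)) , along-new-old rank bound (proj₂ (adj-old h))

      rank′-≢ : ∀ {x y} → Adj F′ x y → rank′ x ≢ rank′ y
      rank′-≢ h with adj-cases h
      ... | inj₁ old rewrite proj₁ (rank′-old old) | proj₂ (rank′-old old) = rank-≢ old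
      ... | inj₂ (inj₁ (refl , ny)) = λ eq → ℕ.<-irrefl eq (v<new ny)
      ... | inj₂ (inj₂ (refl , nx)) = λ eq → ℕ.<-irrefl (sym eq) (v<new nx)

      ascent-into-old : ∀ {a b} → Adj F′ a b → new b ≡ false → rank′ a < rank′ b → Adj F a b
      ascent-into-old h nb lt with adj-cases h
      ... | inj₁ old                 = old
      ... | inj₂ (inj₁ (_ , e))      = False-elim (≡true⇒≢false e nb)
      ... | inj₂ (inj₂ (refl , na)) = False-elim (ℕ.<-asym lt (v<new na))

      descent-from-old : ∀ {b c} → Adj F′ b c → new b ≡ false → rank′ c < rank′ b → Adj F b c
      descent-from-old h nb lt with adj-cases h
      ... | inj₁ old                 = old
      ... | inj₂ (inj₁ (refl , nc)) = False-elim (ℕ.<-asym lt (v<new nc))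
      ... | inj₂ (inj₂ (_ , e))      = False-elim (≡true⇒≢false e nb)

      lower-unique′ : ∀ {a b c} → Adj F′ a b → Adj F′ b c →
        rank′ a < rank′ b → rank′ c < rank′ b → a ≡ c
      lower-unique′ {a} {b} {c} h₁ h₂ a<b c<b = by-age-of-b (new b) refl
        where
          by-age-of-b : ∀ t → new b ≡ t → a ≡ c
          by-age-of-b true  nb = trans (only-v-next-to-new h₁ nb) (sym (new-only-next-to-v h₂ nb))
          by-age-of-b false nb = lower-unique old₁ old₂
            (subst₂ _<_ (proj₁ (rank′-old old₁)) (proj₂ (rank′-old old₁)) a<b)
            (subst₂ _<_ (proj₂ (rank′-old old₂)) (proj₁ (rank′-old old₂)) c<b)
            where
              old₁ = ascent-into-old h₁ nb a<b
              old₂ = descent-from-old h₂ nb c<b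

∈⇒lookup : ∀ {p : Subset n} {x} → x ∈ p → lookup p x ≡ true
∈⇒lookup = []=⇒lookup

lookup⇒∈ : ∀ {p : Subset n} {x} → lookup p x ≡ true → x ∈ p
lookup⇒∈ {p = p} {x} = lookup⇒[]= x p

lookup-∪ : ∀ (p q : Subset n) x → lookup (p ∪ q) x ≡ lookup p x ∨ lookup q x
lookup-∪ p q x = lookup-zipWith _∨_ x p q

lookup-∁ : ∀ (p : Subset n) x → lookup (∁ p) x ≡ not (lookup p x)
lookup-∁ p x = lookup-map x not p

lookup-─ : ∀ (p q : Subset n) x → lookup (p ─ q) x ≡ lookup p x ∧ not (lookup q x)
lookup-─ (a ∷ p) (true  ∷ q) zero    = sym (∧-zeroʳ a)
lookup-─ (a ∷ p) (false ∷ q) zero    = sym (∧-identityʳ a)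
lookup-─ (a ∷ p) (b     ∷ q) (suc x) = lookup-─ p q x

lookup-⊥ : ∀ (x : Fin n) → lookup ⊥ x ≡ false
lookup-⊥ x = lookup-replicate x false

eqB-refl : ∀ (x : Fin n) → eqB x x ≡ true
eqB-refl x with x ≟ x
... | yes _  = refl
... | no x≢x = contradiction refl x≢x

eqB⇒≡ : ∀ {x y : Fin n} → eqB x y ≡ true → x ≡ y
eqB⇒≡ {x = x} {y} e with x ≟ y
... | yes x≡y = x≡y

≢⇒eqB-false : ∀ {x y : Fin n} → x ≢ y → eqB x y ≡ false
≢⇒eqB-false {x = x} {y} x≢y with x ≟ y
... | yes x≡y = contradiction x≡y x≢y
... | no _    = refl

lookup-⁅⁆ : ∀ (v x : Fin n) → lookup ⁅ v ⁆ x ≡ eqB x v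
lookup-⁅⁆ v x with x ≟ v
... | yes refl = ∈⇒lookup (x∈⁅x⁆ v)
... | no x≢v with lookup ⁅ v ⁆ x in e
...   | true  = contradiction (lookup⇒∈ e) (x≢y⇒x∉⁅y⁆ x≢v)
...   | false = refl

lookup-injective : ∀ {A : Set} (p q : Vec A n) → (∀ x → lookup p x ≡ lookup q x) → p ≡ q
lookup-injective p q p≗q = trans (sym (tabulate∘lookup p)) (trans (tabulate-cong p≗q) (tabulate∘lookup q))

anyB⇒Nonempty : ∀ (p : Subset n) → anyB p ≡ true → Nonempty p
anyB⇒Nonempty (true  ∷ p) _ = zero , here
anyB⇒Nonempty (false ∷ p) e with anyB⇒Nonempty p e
... | x , x∈p = suc x , there x∈p

¬anyB⇒lookup-false : ∀ (p : Subset n) → anyB p ≡ false → ∀ x → lookup p x ≡ false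
¬anyB⇒lookup-false (false ∷ p) e zero    = refl
¬anyB⇒lookup-false (false ∷ p) e (suc x) = ¬anyB⇒lookup-false p e x

firstOutside-just : ∀ (p : Subset n) {u} → firstOutside p ≡ just u →
  lookup p u ≡ false × (∀ y → lookup p y ≡ false → u ≤ y)
firstOutside-just (false ∷ p) refl = refl , λ _ _ → z≤n
firstOutside-just (true  ∷ p) e with firstOutside p in e′
firstOutside-just (true  ∷ p) refl | just u with firstOutside-just p e′
... | u∉p , u-least = u∉p , λ { zero () ; (suc y) y∉p → s≤s (u-least y y∉p) }

firstOutside-nothing : ∀ (p : Subset n) → firstOutside p ≡ nothing → ∀ y → lookup p y ≡ true
firstOutside-nothing (true ∷ p) e zero = refl
firstOutside-nothing (true ∷ p) e (suc y) with firstOutside p in e′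
... | nothing = firstOutside-nothing p e′ y

restart-just : ∀ (p : Subset n) {u} → firstOutside p ≡ just u → restart p ≡ ⁅ u ⁆
restart-just p e with firstOutside p
restart-just p refl | just _ = refl

restart-nothing : ∀ (p : Subset n) → firstOutside p ≡ nothing → restart p ≡ ⊥
restart-nothing p e with firstOutside p
restart-nothing p refl | nothing = refl

∈∁⇒lookup-false : ∀ {p : Subset n} {x} → x ∈ ∁ p → lookup p x ≡ false
∈∁⇒lookup-false {p = p} {x} x∈∁p = not-injective (trans (sym (lookup-∁ p x)) (∈⇒lookup x∈∁p))

lookup-false⇒∈∁ : ∀ {p : Subset n} {x} → lookup p x ≡ false → x ∈ ∁ p
lookup-false⇒∈∁ {p = p} {x} px = lookup⇒∈ (trans (lookup-∁ p x) (cong not px))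

all-lookup-true⇒∣p∣≡n : ∀ (p : Subset n) → (∀ x → lookup p x ≡ true) → ∣ p ∣ ≡ n
all-lookup-true⇒∣p∣≡n {n} p all = trans (cong ∣_∣ p≡⊤) (∣⊤∣≡n n)
  where
    p≡⊤ : p ≡ ⊤
    p≡⊤ = lookup-injective p ⊤ λ x → trans (all x) (sym (lookup-replicate x true))

∣p∪⁅x⁆∣≡1+∣p∣ : ∀ (p : Subset n) x → lookup p x ≡ false → ∣ p ∪ ⁅ x ⁆ ∣ ≡ suc ∣ p ∣
∣p∪⁅x⁆∣≡1+∣p∣ (false ∷ p) zero    refl rewrite ∪-identityʳ p = refl
∣p∪⁅x⁆∣≡1+∣p∣ (true  ∷ p) (suc x) e    = cong suc (∣p∪⁅x⁆∣≡1+∣p∣ p x e)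
∣p∪⁅x⁆∣≡1+∣p∣ (false ∷ p) (suc x) e    = ∣p∪⁅x⁆∣≡1+∣p∣ p x e

∣a∩∁∁⊥∣≡0 : ∀ (a : Subset n) → ∣ a ∩ ∁ (∁ ⊥) ∣ ≡ 0
∣a∩∁∁⊥∣≡0 []          = refl
∣a∩∁∁⊥∣≡0 (true  ∷ a) = ∣a∩∁∁⊥∣≡0 a
∣a∩∁∁⊥∣≡0 (false ∷ a) = ∣a∩∁∁⊥∣≡0 a

∣a∩∁∁[p∪⁅x⁆]∣ : ∀ (a p : Subset n) x → lookup p x ≡ false →
  ∣ a ∩ ∁ (∁ (p ∪ ⁅ x ⁆)) ∣ ≡
  (if lookup a x then suc ∣ a ∩ ∁ (∁ p) ∣ else ∣ a ∩ ∁ (∁ p) ∣)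
∣a∩∁∁[p∪⁅x⁆]∣ (true  ∷ a) (false ∷ p) zero    refl rewrite ∪-identityʳ p = refl
∣a∩∁∁[p∪⁅x⁆]∣ (false ∷ a) (false ∷ p) zero    refl rewrite ∪-identityʳ p = refl
∣a∩∁∁[p∪⁅x⁆]∣ (b     ∷ a) (c     ∷ p) (suc x) e
  with b | c | lookup a x | ∣a∩∁∁[p∪⁅x⁆]∣ a p x e
... | true  | true  | true  | ih = cong suc ih
... | true  | true  | false | ih = cong suc ih
... | true  | false | _     | ih = ih
... | false | _     | _     | ih = ih

≤-if-suc : ∀ b m → m ℕ.≤ (if b then suc m else m)
≤-if-suc true  m = ℕ.n≤1+n m
≤-if-suc false m = ℕ.≤-refl

-- Counter values

crossesMinusOne : Maybe ℤ → Maybe ℤ → Bool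
crossesMinusOne old new = isMinusOne new ∧ not (isMinusOne old)

crossesMinusOne-refl : ∀ x → crossesMinusOne x x ≡ false
crossesMinusOne-refl x with isMinusOne x
... | true  = refl
... | false = refl

decr-⊖ : ∀ k c → decr (just (k ⊖ c)) ≡ just (k ⊖ suc c)
decr-⊖ k c = cong just (trans (distribˡ-⊖-+-neg 0 k c) (cong (k ⊖_) (ℕ.+-identityʳ (suc c))))

isMinusOne-⊖ : ∀ k c → isMinusOne (just (k ⊖ c)) ≡ true → c ≡ suc k
isMinusOne-⊖ zero    (suc zero) e = refl
isMinusOne-⊖ (suc k) (suc c)    e rewrite [1+m]⊖[1+n]≡m⊖n k c = cong suc (isMinusOne-⊖ k c e)

isMinusOne-⊖-suc : ∀ k → isMinusOne (just (k ⊖ suc k)) ≡ true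
isMinusOne-⊖-suc zero    = refl
isMinusOne-⊖-suc (suc k) rewrite [1+m]⊖[1+n]≡m⊖n k (suc k) = isMinusOne-⊖-suc k

crossesMinusOne-if : ∀ b x → crossesMinusOne x (if b then decr x else x) ≡ true →
  b ≡ true × crossesMinusOne x (decr x) ≡ true
crossesMinusOne-if true  x e = refl , e
crossesMinusOne-if false x e = contradiction (crossesMinusOne-refl x) (≡true⇒≢false e)

crossesMinusOne-decr⇒ : ∀ (m : ℕ∞) c →
  crossesMinusOne (Maybe.map (_⊖ c) m) (decr (Maybe.map (_⊖ c) m)) ≡ true → m ≡ just c
crossesMinusOne-decr⇒ (just k) c e rewrite decr-⊖ k c with isMinusOne (just (k ⊖ suc c)) in e′
... | true = cong just (sym (ℕ.suc-injective (isMinusOne-⊖ k (suc c) e′)))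

crossesMinusOne-decr⇐ : ∀ c → crossesMinusOne (just (c ⊖ c)) (decr (just (c ⊖ c))) ≡ true
crossesMinusOne-decr⇐ c rewrite decr-⊖ c c | isMinusOne-⊖-suc c | n⊖n≡0 c = refl

decr-if-map-⊖ : ∀ b (m : ℕ∞) c →
  (if b then decr (Maybe.map (_⊖ c) m) else Maybe.map (_⊖ c) m) ≡ Maybe.map (_⊖ (if b then suc c else c)) m
decr-if-map-⊖ true  nothing  c = refl
decr-if-map-⊖ true  (just k) c = decr-⊖ k c
decr-if-map-⊖ false m        c = refl

-- Algorithm A

module Algorithm {n} (G : SimpleGraph n) (γ : Subgraph n → Subset n → Fin n)
  (γ-choice : IsChoiceFunction G γ) (f : Fin n → ℕ∞) (f-parking : IsMultiparking G f) where

  nbrsIn : Subset n → Fin n → ℕ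
  nbrsIn P w = outdeg G (∁ P) w

  adjB : Fin n → Fin n → Bool
  adjB u w = lookup (lookup (adj G) u) w

  adjB-sym : ∀ u w → adjB u w ≡ adjB w u
  adjB-sym u w with adjB u w in e₁ | adjB w u in e₂
  ... | true  | true  = refl
  ... | false | false = refl
  ... | true  | false = contradiction e₂ (≡true⇒≢false (∈⇒lookup (adj-sym G u w (lookup⇒∈ e₁))))
  ... | false | true  = contradiction e₁ (≡true⇒≢false (∈⇒lookup (adj-sym G w u (lookup⇒∈ e₂))))

  nbrsIn-insert : ∀ P v w → lookup P v ≡ false →
    nbrsIn (P ∪ ⁅ v ⁆) w ≡ (if adjB w v then suc (nbrsIn P w) else nbrsIn P w)
  nbrsIn-insert P v w = ∣a∩∁∁[p∪⁅x⁆]∣ (lookup (adj G) w) P v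

  record Active (i : ℕ) (s : State n) (root : Fin n → Fin n) : Set where
    field
      treeRoot         : Fin n
      treeRoot-least   : ∀ y → lookup (P s) y ≡ false → treeRoot ≤ y
      queue-admissible : AdmissibleW (F s) (Q s)
      -- the counter of a queued vertex is already negative
      queue-pending    : ∀ w → lookup (Q s) w ≡ true →
        lookup (P s) w ≡ false × root w ≡ treeRoot × (∀ k → f w ≡ just k → k < nbrsIn (P s) w)

  record Invariant (i : ℕ) (s : State n) : Set where
    field
      card-P          : ∣ P s ∣ ≡ i
      subgraph        : IsSubgraphOf (F s) G
      verts≡P∪Q       : ∀ x → lookup (verts (F s)) x ≡ lookup (P s) x ∨ lookup (Q s) x
      ranking         : LowerNeighbourRanking (F s)
      root            : Fin n → Fin n
      root-adj        : ∀ {x y} → Adj (F s) x y → root x ≡ root y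
      reach-root      : ∀ x → lookup (verts (F s)) x ≡ true → Reach (F s) x (root x)
      root-∞          : ∀ x → lookup (verts (F s)) x ≡ true → f (root x) ≡ ∞
      root-≤          : ∀ x → lookup (verts (F s)) x ≡ true → root x ≤ x
      ∞-is-root       : ∀ x → lookup (verts (F s)) x ≡ true → f x ≡ ∞ → root x ≡ x
      -- a vertex starting a new tree is then already its own root
      root-outside    : ∀ x → lookup (verts (F s)) x ≡ false → root x ≡ x
      val-unprocessed : ∀ w → lookup (P s) w ≡ false → val s w ≡ Maybe.map (_⊖ nbrsIn (P s) w) (f w)
      unqueued-parked : ∀ w → lookup (P s) w ≡ false → lookup (Q s) w ≡ false →
        ∀ k → f w ≡ just k → nbrsIn (P s) w ℕ.≤ k
      -- while some vertex is unprocessed, γ is applied to an admissible queue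
      active          : i < n → Active i s root

  module Step {val P Q F} {i} (inv : Invariant i (st val P Q F)) (i<n : i < n) where
    open Invariant inv
    open Active (active i<n)

    v : Fin n
    v = γ F Q

    hit : Fin n → Bool
    hit w = adjB v w ∧ not (lookup P w)

    val′ : Fin n → Maybe ℤ
    val′ w = if hit w then decr (val w) else val w

    N : Subset n
    N = tabulate (λ w → crossesMinusOne (val w) (val′ w))

    P′ : Subset n
    P′ = P ∪ ⁅ v ⁆

    Q₁ : Subset n
    Q₁ = (Q ∪ N) ─ ⁅ v ⁆

    edges′ : Vec (Subset n) n
    edges′ = tabulate (λ u → tabulate (λ w →
      lookup (lookup (edges F) u) w ∨ (eqB u v ∧ lookup N w) ∨ (eqB w v ∧ lookup N u)))

    F′ : Subset n → Subgraph n
    F′ X = mkSubgraph (P′ ∪ X) edges′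

    NextInvariant : Subset n → Set
    NextInvariant X = Invariant (suc i) (st val′ P′ X (F′ X))

    P⇒F : ∀ x → lookup P x ≡ true → lookup (verts F) x ≡ true
    P⇒F x e = trans (verts≡P∪Q x) (cong (_∨ lookup Q x) e)

    Q⇒F : ∀ x → lookup Q x ≡ true → lookup (verts F) x ≡ true
    Q⇒F x e = trans (verts≡P∪Q x) (trans (cong (lookup P x ∨_) e) (∨-zeroʳ (lookup P x)))

    F⇒P⊎Q : ∀ x → lookup (verts F) x ≡ true → lookup P x ≡ true ⊎ lookup Q x ≡ true
    F⇒P⊎Q x e = ∨-true⁻ _ _ (trans (sym (verts≡P∪Q x)) e)

    v∈Q : lookup Q v ≡ true
    v∈Q = ∈⇒lookup (γ-choice F Q (subgraph , ranked⇒acyclic ranking) queue-admissible)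

    v∉P : lookup P v ≡ false
    v∉P = proj₁ (queue-pending v v∈Q)

    v∈F : lookup (verts F) v ≡ true
    v∈F = Q⇒F v v∈Q

    lookup-N : ∀ w → lookup N w ≡ crossesMinusOne (val w) (val′ w)
    lookup-N w = lookup∘tabulate _ w

    attached⇒ : ∀ w → lookup N w ≡ true → lookup P w ≡ false × adjB v w ≡ true × f w ≡ just (nbrsIn P w)
    attached⇒ w e =
      let hit-w , crosses = crossesMinusOne-if (hit w) (val w) (trans (sym (lookup-N w)) e)
          avw , pw = ∧-not-true⁻ (adjB v w) (lookup P w) hit-w
      in pw , avw , crossesMinusOne-decr⇒ (f w) (nbrsIn P w)
           (subst (λ x → crossesMinusOne x (decr x) ≡ true) (val-unprocessed w pw) crosses)

    attached⇐ : ∀ w → lookup P w ≡ false → adjB v w ≡ true → f w ≡ just (nbrsIn P w) → lookup N w ≡ true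
    attached⇐ w pw avw fw rewrite lookup-N w | avw | pw | val-unprocessed w pw | fw =
      crossesMinusOne-decr⇐ (nbrsIn P w)

    attached∉Q : ∀ w → lookup N w ≡ true → lookup Q w ≡ false
    attached∉Q w nw = ¬-not λ qw →
      ℕ.<-irrefl refl (proj₂ (proj₂ (queue-pending w qw)) _ (proj₂ (proj₂ (attached⇒ w nw))))

    attached∉F : ∀ w → lookup N w ≡ true → lookup (verts F) w ≡ false
    attached∉F w nw = trans (verts≡P∪Q w) (cong₂ _∨_ (proj₁ (attached⇒ w nw)) (attached∉Q w nw))

    F⇒unattached : ∀ w → lookup (verts F) w ≡ true → lookup N w ≡ false
    F⇒unattached w e = ¬-not λ nw → ≡true⇒≢false e (attached∉F w nw)

    v-unattached : lookup N v ≡ false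
    v-unattached = F⇒unattached v v∈F

    attached≢v : ∀ w → lookup N w ≡ true → w ≢ v
    attached≢v w nw refl = contradiction v-unattached (≡true⇒≢false nw)

    lookup-edges′ : ∀ u w → lookup (lookup edges′ u) w ≡
      lookup (lookup (edges F) u) w ∨ (eqB u v ∧ lookup N w) ∨ (eqB w v ∧ lookup N u)
    lookup-edges′ u w = trans (cong (λ r → lookup r w) (lookup∘tabulate _ u)) (lookup∘tabulate _ w)

    adj′-cases : ∀ {X x y} → Adj (F′ X) x y →
      Adj F x y ⊎ (x ≡ v × lookup N y ≡ true) ⊎ (y ≡ v × lookup N x ≡ true)
    adj′-cases {x = x} {y} h with lookup (lookup (edges F) x) y in exy | eqB x v in xv | lookup N y in ny
                               | eqB y v in yv | lookup N x in nx | trans (sym (lookup-edges′ x y)) (∈⇒lookup h)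
    ... | true  | _    | _    | _    | _    | _ = inj₁ (lookup⇒∈ exy)
    ... | false | true | true | _    | _    | _ = inj₂ (inj₁ (eqB⇒≡ xv , refl))
    ... | false | true | false | true | true | _ = inj₂ (inj₂ (eqB⇒≡ yv , refl))
    ... | false | false | _   | true | true | _ = inj₂ (inj₂ (eqB⇒≡ yv , refl))

    adj′-old : ∀ {X x y} → Adj F x y → Adj (F′ X) x y
    adj′-old {x = x} {y} h = lookup⇒∈ (trans (lookup-edges′ x y)
      (cong (λ a → a ∨ (eqB x v ∧ lookup N y) ∨ (eqB y v ∧ lookup N x)) (∈⇒lookup h)))

    adj′-v-attached : ∀ {X y} → lookup N y ≡ true → Adj (F′ X) v y
    adj′-v-attached {y = y} ny = lookup⇒∈ (trans (lookup-edges′ v y) g)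
      where
        g : lookup (lookup (edges F) v) y ∨ (eqB v v ∧ lookup N y) ∨ (eqB y v ∧ lookup N v) ≡ true
        g rewrite eqB-refl v | ny = ∨-zeroʳ _

    adj′-attached-v : ∀ {X x} → lookup N x ≡ true → Adj (F′ X) x v
    adj′-attached-v {x = x} nx = lookup⇒∈ (trans (lookup-edges′ x v) g)
      where
        g : lookup (lookup (edges F) x) v ∨ (eqB x v ∧ lookup N v) ∨ (eqB v v ∧ lookup N x) ≡ true
        g rewrite eqB-refl v | nx | ∨-zeroʳ (eqB x v ∧ lookup N v) = ∨-zeroʳ _

    reach′-old : ∀ {X x y} → Reach F x y → Reach (F′ X) x y
    reach′-old here           = here
    reach′-old {X} (there xy y⇝z) = there (adj′-old {X} xy) (reach′-old y⇝z)

    adj-unattached : ∀ {x y} → Adj F x y → lookup N x ≡ false × lookup N y ≡ false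
    adj-unattached {x} {y} h with subgraph x y h
    ... | x∈F , y∈F , _ = F⇒unattached x (∈⇒lookup x∈F) , F⇒unattached y (∈⇒lookup y∈F)

    row′-unattached : ∀ w → lookup N w ≡ false → w ≢ v → lookup edges′ w ≡ lookup (edges F) w
    row′-unattached w nw w≢v = lookup-injective _ _ λ u → trans (lookup-edges′ w u) (g u)
      where
        g : ∀ u → lookup (lookup (edges F) w) u ∨ (eqB w v ∧ lookup N u) ∨ (eqB u v ∧ lookup N w)
                  ≡ lookup (lookup (edges F) w) u
        g u rewrite ≢⇒eqB-false w≢v | nw | ∧-zeroʳ (eqB u v) = ∨-identityʳ _

    row′-attached : ∀ w → lookup N w ≡ true → lookup edges′ w ≡ ⁅ v ⁆
    row′-attached w nw = lookup-injective _ _ λ u → trans (lookup-edges′ w u) (trans (g u) (sym (lookup-⁅⁆ v u)))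
      where
        no-old-edge : ∀ u → lookup (lookup (edges F) w) u ≡ false
        no-old-edge u = ¬-not λ e →
          ≡true⇒≢false (∈⇒lookup (proj₁ (subgraph w u (lookup⇒∈ e)))) (attached∉F w nw)
        g : ∀ u → lookup (lookup (edges F) w) u ∨ (eqB w v ∧ lookup N u) ∨ (eqB u v ∧ lookup N w) ≡ eqB u v
        g u rewrite no-old-edge u | ≢⇒eqB-false (attached≢v w nw) | nw = ∧-identityʳ (eqB u v)

    lookup-P′ : ∀ x → lookup P′ x ≡ lookup P x ∨ eqB x v
    lookup-P′ x = trans (lookup-∪ P ⁅ v ⁆ x) (cong (lookup P x ∨_) (lookup-⁅⁆ v x))

    P′-false⁻ : ∀ w → lookup P′ w ≡ false → lookup P w ≡ false × w ≢ v
    P′-false⁻ w e with ∨-false⁻ _ _ (trans (sym (lookup-P′ w)) e)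
    ... | pw , wv = pw , λ { refl → contradiction wv (≡true⇒≢false (eqB-refl w)) }

    P′-false⁺ : ∀ w → lookup P w ≡ false → w ≢ v → lookup P′ w ≡ false
    P′-false⁺ w pw w≢v = trans (lookup-P′ w) (cong₂ _∨_ pw (≢⇒eqB-false w≢v))

    P⇒P′ : ∀ w → lookup P w ≡ true → lookup P′ w ≡ true
    P⇒P′ w e = trans (lookup-P′ w) (cong (_∨ eqB w v) e)

    v∈P′ : lookup P′ v ≡ true
    v∈P′ = trans (lookup-P′ v) (trans (cong (lookup P v ∨_) (eqB-refl v)) (∨-zeroʳ (lookup P v)))

    card-P′ : ∣ P′ ∣ ≡ suc i
    card-P′ = trans (∣p∪⁅x⁆∣≡1+∣p∣ P v v∉P) (cong suc card-P)

    lookup-Q₁ : ∀ x → lookup Q₁ x ≡ (lookup Q x ∨ lookup N x) ∧ not (eqB x v)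
    lookup-Q₁ x = trans (lookup-─ (Q ∪ N) ⁅ v ⁆ x)
      (cong₂ (λ a b → a ∧ not b) (lookup-∪ Q N x) (lookup-⁅⁆ v x))

    Q₁-true⁻ : ∀ w → lookup Q₁ w ≡ true → (lookup Q w ≡ true ⊎ lookup N w ≡ true) × w ≢ v
    Q₁-true⁻ w e with ∧-not-true⁻ _ _ (trans (sym (lookup-Q₁ w)) e)
    ... | q∨n , wv = ∨-true⁻ _ _ q∨n , λ { refl → contradiction wv (≡true⇒≢false (eqB-refl w)) }

    Q₁-true⁺ : ∀ w → lookup Q w ≡ true ⊎ lookup N w ≡ true → w ≢ v → lookup Q₁ w ≡ true
    Q₁-true⁺ w q⊎n w≢v rewrite lookup-Q₁ w | ≢⇒eqB-false w≢v with q⊎n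
    ... | inj₁ qw rewrite qw = refl
    ... | inj₂ nw rewrite nw | ∨-zeroʳ (lookup Q w) = refl

    attached⇒Q₁ : ∀ w → lookup N w ≡ true → lookup Q₁ w ≡ true
    attached⇒Q₁ w nw = Q₁-true⁺ w (inj₂ nw) (attached≢v w nw)

    nbrsIn-P′ : ∀ w → nbrsIn P′ w ≡ (if adjB v w then suc (nbrsIn P w) else nbrsIn P w)
    nbrsIn-P′ w = trans (nbrsIn-insert P v w v∉P) (cong (λ b → if b then _ else _) (adjB-sym w v))

    val′-unprocessed : ∀ w → lookup P′ w ≡ false → val′ w ≡ Maybe.map (_⊖ nbrsIn P′ w) (f w)
    val′-unprocessed w e = begin
      (if hit w then decr (val w) else val w)
        ≡⟨ cong (λ b → if b then decr (val w) else val w) hit≡adjB ⟩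
      (if adjB v w then decr (val w) else val w)
        ≡⟨ cong (λ x → if adjB v w then decr x else x) (val-unprocessed w pw) ⟩
      (if adjB v w then decr (Maybe.map (_⊖ c) (f w)) else Maybe.map (_⊖ c) (f w))
        ≡⟨ decr-if-map-⊖ (adjB v w) (f w) c ⟩
      Maybe.map (_⊖ (if adjB v w then suc c else c)) (f w)
        ≡⟨ cong (λ c′ → Maybe.map (_⊖ c′) (f w)) (sym (nbrsIn-P′ w)) ⟩
      Maybe.map (_⊖ nbrsIn P′ w) (f w) ∎
      where
        open ≡-Reasoning
        c = nbrsIn P w
        pw = proj₁ (P′-false⁻ w e)
        hit≡adjB : hit w ≡ adjB v w
        hit≡adjB rewrite pw = ∧-identityʳ (adjB v w)

    unqueued-parked′ : ∀ w → lookup P′ w ≡ false → lookup Q₁ w ≡ false →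
      ∀ k → f w ≡ just k → nbrsIn P′ w ℕ.≤ k
    unqueued-parked′ w e q₁w k fw = subst (ℕ._≤ k) (sym (nbrsIn-P′ w)) (by-adjacency (adjB v w) refl)
      where
        pw = proj₁ (P′-false⁻ w e)
        w≢v = proj₂ (P′-false⁻ w e)
        qw : lookup Q w ≡ false
        qw = ¬-not λ qw → ≡true⇒≢false (Q₁-true⁺ w (inj₁ qw) w≢v) q₁w
        nw : lookup N w ≡ false
        nw = ¬-not λ nw → ≡true⇒≢false (Q₁-true⁺ w (inj₂ nw) w≢v) q₁w
        c≤k : nbrsIn P w ℕ.≤ k
        c≤k = unqueued-parked w pw qw k fw
        by-adjacency : ∀ b → adjB v w ≡ b → (if b then suc (nbrsIn P w) else nbrsIn P w) ℕ.≤ k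
        by-adjacency false _   = c≤k
        by-adjacency true  avw = ℕ.≤∧≢⇒< c≤k λ { refl → ≡true⇒≢false (attached⇐ w pw avw fw) nw }

    -- X is the next queue: Q₁, or when Q₁ is empty a single fresh root or nothing.
    module Extend (X : Subset n)
      (Q₁⊆X : ∀ w → lookup Q₁ w ≡ true → lookup X w ≡ true)
      (X⊆Q₁∪fresh : ∀ x → lookup X x ≡ true →
        lookup Q₁ x ≡ true ⊎ (lookup (verts F) x ≡ false × lookup N x ≡ false × f x ≡ ∞)) where

      verts′ : ∀ x → lookup (verts (F′ X)) x ≡ lookup P′ x ∨ lookup X x
      verts′ x = lookup-∪ P′ X x

      P′⇒F′ : ∀ x → lookup P′ x ≡ true → lookup (verts (F′ X)) x ≡ true
      P′⇒F′ x e = trans (verts′ x) (cong (_∨ lookup X x) e)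

      X⇒F′ : ∀ x → lookup X x ≡ true → lookup (verts (F′ X)) x ≡ true
      X⇒F′ x e = trans (verts′ x) (trans (cong (lookup P′ x ∨_) e) (∨-zeroʳ (lookup P′ x)))

      F⇒F′ : ∀ x → lookup (verts F) x ≡ true → lookup (verts (F′ X)) x ≡ true
      F⇒F′ x e with F⇒P⊎Q x e
      ... | inj₁ px = P′⇒F′ x (P⇒P′ x px)
      ... | inj₂ qx with x ≟ v
      ...   | yes refl = P′⇒F′ v v∈P′
      ...   | no x≢v   = X⇒F′ x (Q₁⊆X x (Q₁-true⁺ x (inj₁ qx) x≢v))

      attached⇒F′ : ∀ x → lookup N x ≡ true → lookup (verts (F′ X)) x ≡ true
      attached⇒F′ x nx = X⇒F′ x (Q₁⊆X x (attached⇒Q₁ x nx))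

      data Origin (x : Fin n) : Set where
        old      : lookup (verts F) x ≡ true → Origin x
        attached : lookup N x ≡ true → Origin x
        fresh    : lookup (verts F) x ≡ false → lookup N x ≡ false → f x ≡ ∞ → Origin x

      origin : ∀ x → lookup (verts (F′ X)) x ≡ true → Origin x
      origin x e with ∨-true⁻ _ _ (trans (sym (verts′ x)) e)
      ... | inj₁ p′x with ∨-true⁻ _ _ (trans (sym (lookup-P′ x)) p′x)
      ...   | inj₁ px = old (P⇒F x px)
      ...   | inj₂ xv with eqB⇒≡ xv
      ...     | refl = old v∈F
      origin x e | inj₂ xX with X⊆Q₁∪fresh x xX
      ... | inj₂ (x∉F , nx , fx) = fresh x∉F nx fx
      ... | inj₁ q₁x with proj₁ (Q₁-true⁻ x q₁x)
      ...   | inj₁ qx = old (Q⇒F x qx)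
      ...   | inj₂ nx = attached nx

      subgraph′ : IsSubgraphOf (F′ X) G
      subgraph′ u w h with adj′-cases {X} h
      ... | inj₁ uw with subgraph u w uw
      ...   | u∈F , w∈F , wu , uw-in-G =
        lookup⇒∈ (F⇒F′ u (∈⇒lookup u∈F)) , lookup⇒∈ (F⇒F′ w (∈⇒lookup w∈F)) ,
        adj′-old {X} wu , uw-in-G
      subgraph′ u w h | inj₂ (inj₁ (refl , nw)) =
        lookup⇒∈ (P′⇒F′ v v∈P′) , lookup⇒∈ (attached⇒F′ w nw) , adj′-attached-v {X} nw ,
        lookup⇒∈ (proj₁ (proj₂ (attached⇒ w nw)))
      subgraph′ u w h | inj₂ (inj₂ (refl , nu)) =
        lookup⇒∈ (attached⇒F′ u nu) , lookup⇒∈ (P′⇒F′ v v∈P′) , adj′-v-attached {X} nu ,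
        lookup⇒∈ (trans (adjB-sym u v) (proj₁ (proj₂ (attached⇒ u nu))))

      open AttachLeaves {F = F} {F′ = F′ X} v (lookup N) (adj′-cases {X}) adj-unattached v-unattached

      root′ : Fin n → Fin n
      root′ = along-new root (root v)

      root′-old : ∀ x → lookup N x ≡ false → root′ x ≡ root x
      root′-old x = along-new-old root (root v)

      root′-attached : ∀ x → lookup N x ≡ true → root′ x ≡ root v
      root′-attached x = along-new-new root (root v)

      root′-fresh : ∀ x → lookup (verts F) x ≡ false → lookup N x ≡ false → root′ x ≡ x
      root′-fresh x x∉F nx = trans (root′-old x nx) (root-outside x x∉F)

      reach-root′ : ∀ x → lookup (verts (F′ X)) x ≡ true → Reach (F′ X) x (root′ x)
      reach-root′ x e with origin x e
      ... | old x∈F = subst (Reach (F′ X) x) (sym (root′-old x (F⇒unattached x x∈F)))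
                        (reach′-old (reach-root x x∈F))
      ... | attached nx = subst (Reach (F′ X) x) (sym (root′-attached x nx))
                            (there (adj′-attached-v {X} nx) (reach′-old (reach-root v v∈F)))
      ... | fresh x∉F nx _ = subst (Reach (F′ X) x) (sym (root′-fresh x x∉F nx)) here

      root′-∞ : ∀ x → lookup (verts (F′ X)) x ≡ true → f (root′ x) ≡ ∞
      root′-∞ x e with origin x e
      ... | old x∈F = subst (λ r → f r ≡ ∞) (sym (root′-old x (F⇒unattached x x∈F))) (root-∞ x x∈F)
      ... | attached nx = subst (λ r → f r ≡ ∞) (sym (root′-attached x nx)) (root-∞ v v∈F)
      ... | fresh x∉F nx fx = subst (λ r → f r ≡ ∞) (sym (root′-fresh x x∉F nx)) fx

      root′-≤ : ∀ x → lookup (verts (F′ X)) x ≡ true → root′ x ≤ x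
      root′-≤ x e with origin x e
      ... | old x∈F = subst (_≤ x) (sym (root′-old x (F⇒unattached x x∈F))) (root-≤ x x∈F)
      ... | attached nx = subst (_≤ x) (sym (trans (root′-attached x nx) (proj₁ (proj₂ (queue-pending v v∈Q)))))
                            (treeRoot-least x (proj₁ (attached⇒ x nx)))
      ... | fresh x∉F nx _ = subst (_≤ x) (sym (root′-fresh x x∉F nx)) Fin.≤-refl

      ∞-is-root′ : ∀ x → lookup (verts (F′ X)) x ≡ true → f x ≡ ∞ → root′ x ≡ x
      ∞-is-root′ x e fx with origin x e
      ... | old x∈F = trans (root′-old x (F⇒unattached x x∈F)) (∞-is-root x x∈F fx)
      ... | attached nx = False-elim (∞≢just (trans (sym fx) (proj₂ (proj₂ (attached⇒ x nx)))))
      ... | fresh x∉F nx _ = root′-fresh x x∉F nx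

      root′-outside : ∀ x → lookup (verts (F′ X)) x ≡ false → root′ x ≡ x
      root′-outside x e = root′-fresh x
        (¬-not λ x∈F → ≡true⇒≢false (F⇒F′ x x∈F) e)
        (¬-not λ nx → ≡true⇒≢false (attached⇒F′ x nx) e)

      invariant′ : (suc i < n → Active (suc i) (st val′ P′ X (F′ X)) root′) → NextInvariant X
      invariant′ active′ = record
        { card-P = card-P′ ; subgraph = subgraph′ ; verts≡P∪Q = verts′ ; ranking = attach-ranking ranking
        ; root = root′ ; root-adj = along-new-respects-Adj root root-adj ; reach-root = reach-root′
        ; root-∞ = root′-∞ ; root-≤ = root′-≤ ; ∞-is-root = ∞-is-root′ ; root-outside = root′-outside
        ; val-unprocessed = val′-unprocessed
        ; unqueued-parked = λ w e xw →
            unqueued-parked′ w e (¬-not λ q₁w → ≡true⇒≢false (Q₁⊆X w q₁w) xw)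
        ; active = active′ }

    continue-tree : anyB Q₁ ≡ true → NextInvariant Q₁
    continue-tree nonempty = invariant′ (λ _ → active′)
      where
        open Extend Q₁ (λ _ e → e) (λ _ e → inj₁ e)

        leaves : ∀ w → w ∈ Q₁ → IsLeaf (F′ Q₁) w
        leaves w w∈Q₁ with Q₁-true⁻ w (∈⇒lookup w∈Q₁)
        ... | inj₂ nw , _ =
          lookup⇒∈ (X⇒F′ w (∈⇒lookup w∈Q₁)) ,
          trans (cong ∣_∣ (row′-attached w nw)) (∣⁅x⁆∣≡1 v)
        ... | inj₁ qw , w≢v with queue-admissible
        ...   | inj₁ (_ , Q-leaves) =
          lookup⇒∈ (X⇒F′ w (∈⇒lookup w∈Q₁)) ,
          trans (cong ∣_∣ (row′-unattached w (F⇒unattached w (Q⇒F w qw)) w≢v))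
                (proj₂ (Q-leaves w (lookup⇒∈ qw)))
        ...   | inj₂ (u , _ , Q≡⁅u⁆) = contradiction (trans (in-⁅u⁆ qw) (sym (in-⁅u⁆ v∈Q))) w≢v
          where
            in-⁅u⁆ : ∀ {x} → lookup Q x ≡ true → x ≡ u
            in-⁅u⁆ qx = x∈⁅y⁆⇒x≡y u (subst (_ ∈_) Q≡⁅u⁆ (lookup⇒∈ qx))

        pending : ∀ w → lookup Q₁ w ≡ true →
          lookup P′ w ≡ false × root′ w ≡ treeRoot × (∀ k → f w ≡ just k → k < nbrsIn P′ w)
        pending w e with Q₁-true⁻ w e
        ... | inj₁ qw , w≢v with queue-pending w qw
        ...   | pw , rw , below =
          P′-false⁺ w pw w≢v , trans (root′-old w (F⇒unattached w (Q⇒F w qw))) rw ,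
          λ k fw → ℕ.<-≤-trans (below k fw)
                     (subst (nbrsIn P w ℕ.≤_) (sym (nbrsIn-P′ w)) (≤-if-suc (adjB v w) _))
        pending w e | inj₂ nw , w≢v with attached⇒ w nw
        ... | pw , avw , fw =
          P′-false⁺ w pw w≢v , trans (root′-attached w nw) (proj₁ (proj₂ (queue-pending v v∈Q))) ,
          λ k fw′ → subst (k <_) (sym (trans (nbrsIn-P′ w) (cong (λ b → if b then _ else _) avw)))
                      (ℕ.≤-reflexive (cong suc (just-injective (trans (sym fw′) fw))))

        active′ : Active (suc i) (st val′ P′ Q₁ (F′ Q₁)) root′
        active′ = record
          { treeRoot = treeRoot
          ; treeRoot-least = λ y e → treeRoot-least y (proj₁ (P′-false⁻ y e))
          ; queue-admissible = inj₁ (anyB⇒Nonempty Q₁ nonempty , leaves)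
          ; queue-pending = pending }

    module QueueExhausted (exhausted : anyB Q₁ ≡ false) where
      Q₁-false : ∀ x → lookup Q₁ x ≡ false
      Q₁-false = ¬anyB⇒lookup-false Q₁ exhausted

      unattached : ∀ w → lookup N w ≡ false
      unattached w = ¬-not λ nw → ≡true⇒≢false (attached⇒Q₁ w nw) (Q₁-false w)

      Q₁⊆ : ∀ {X : Subset n} w → lookup Q₁ w ≡ true → lookup X w ≡ true
      Q₁⊆ w e = contradiction (Q₁-false w) (≡true⇒≢false e)

      start-tree : ∀ u → firstOutside P′ ≡ just u → NextInvariant ⁅ u ⁆
      start-tree u found = invariant′ (λ _ → active′)
        where
          u∉P′ = proj₁ (firstOutside-just P′ found)
          u-least = proj₂ (firstOutside-just P′ found)
          u∉P = proj₁ (P′-false⁻ u u∉P′)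
          u≢v = proj₂ (P′-false⁻ u u∉P′)

          u∉F : lookup (verts F) u ≡ false
          u∉F = trans (verts≡P∪Q u)
            (cong₂ _∨_ u∉P (¬-not λ qu → ≡true⇒≢false (Q₁-true⁺ u (inj₁ qu) u≢v) (Q₁-false u)))

          -- (B) fails for the unprocessed vertices U = ∁ P′ since nothing is queued.
          new-root-∞ : f u ≡ ∞
          new-root-∞ with f-parking (∁ P′) (u , lookup-false⇒∈∁ u∉P′)
          ... | inj₁ (j , (j∈ , j-least) , fj) =
            subst (λ z → f z ≡ ∞)
              (Fin.≤-antisym (j-least u (lookup-false⇒∈∁ u∉P′)) (u-least j (∈∁⇒lookup-false j∈))) fj
          ... | inj₂ (j , j∈ , k , fj , k<deg) =
            contradiction (unqueued-parked′ j (∈∁⇒lookup-false j∈) (Q₁-false j) k fj) (ℕ.<⇒≱ k<deg)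

          in-⁅u⁆ : ∀ {x} → lookup ⁅ u ⁆ x ≡ true → x ≡ u
          in-⁅u⁆ e = eqB⇒≡ (trans (sym (lookup-⁅⁆ u _)) e)

          u-fresh : ∀ x → lookup ⁅ u ⁆ x ≡ true →
            lookup Q₁ x ≡ true ⊎ (lookup (verts F) x ≡ false × lookup N x ≡ false × f x ≡ ∞)
          u-fresh x e with in-⁅u⁆ e
          ... | refl = inj₂ (u∉F , unattached u , new-root-∞)

          open Extend ⁅ u ⁆ (Q₁⊆ {⁅ u ⁆}) u-fresh

          isolated : degF (F′ ⁅ u ⁆) u ≡ 0
          isolated = trans (cong ∣_∣ (trans (row′-unattached u (unattached u) u≢v) (Empty-unique no-edge)))
                           (∣⊥∣≡0 n)
            where
              no-edge : ¬ Nonempty (lookup (edges F) u)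
              no-edge (x , ux) = ≡true⇒≢false (∈⇒lookup (proj₁ (subgraph u x ux))) u∉F

          active′ : Active (suc i) (st val′ P′ ⁅ u ⁆ (F′ ⁅ u ⁆)) root′
          active′ = record
            { treeRoot = u
            ; treeRoot-least = u-least
            ; queue-admissible = inj₂ (u , (u∈F′ , isolated) , refl)
            ; queue-pending = λ w e → case in-⁅u⁆ e of λ
                { refl → u∉P′ , root′-fresh u u∉F (unattached u) , λ k fu → False-elim (∞≢just (trans (sym new-root-∞) fu)) } }
            where
              u∈F′ : u ∈ verts (F′ ⁅ u ⁆)
              u∈F′ = lookup⇒∈ (X⇒F′ u (trans (lookup-⁅⁆ u u) (eqB-refl u)))

      finish : firstOutside P′ ≡ nothing → NextInvariant (restart P′)
      finish none = invariant′ λ suc-i<n →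
        contradiction suc-i<n (ℕ.<-irrefl (trans (sym card-P′) (all-lookup-true⇒∣p∣≡n P′ P′-full)))
        where
          P′-full = firstOutside-nothing P′ none

          nothing-queued : ∀ x → lookup (restart P′) x ≡ true →
            lookup Q₁ x ≡ true ⊎ (lookup (verts F) x ≡ false × lookup N x ≡ false × f x ≡ ∞)
          nothing-queued x e rewrite restart-nothing P′ none = contradiction (lookup-⊥ x) (≡true⇒≢false e)

          open Extend (restart P′) (Q₁⊆ {restart P′}) nothing-queued

      restart-invariant : NextInvariant (restart P′)
      restart-invariant = by-firstOutside (firstOutside P′) refl
        where
          by-firstOutside : ∀ m → firstOutside P′ ≡ m → NextInvariant (restart P′)
          by-firstOutside (just u) found = subst NextInvariant (sym (restart-just P′ found)) (start-tree u found)
          by-firstOutside nothing none = finish none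

    step-invariant : Invariant (suc i) (step G γ (st val P Q F))
    step-invariant with anyB Q₁ in nonempty
    ... | true  = continue-tree nonempty
    ... | false = QueueExhausted.restart-invariant nonempty

  step-invariant : ∀ {i s} → Invariant i s → i < n → Invariant (suc i) (step G γ s)
  step-invariant {s = st _ _ _ _} inv i<n = Step.step-invariant inv i<n

  iterate-invariant : ∀ k {i s} → k + i ℕ.≤ n → Invariant i s → Invariant (k + i) (iterate k (step G γ) s)
  iterate-invariant zero    _   inv = inv
  iterate-invariant (suc k) {i} {s} 1+k+i≤n inv =
    subst (λ j → Invariant j (iterate k (step G γ) (step G γ s))) (ℕ.+-suc k i)
      (iterate-invariant k (subst (ℕ._≤ n) (sym (ℕ.+-suc k i)) 1+k+i≤n)
        (step-invariant inv (ℕ.<-≤-trans (s≤s (ℕ.m≤n+m i k)) 1+k+i≤n)))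

module Run {m} (G : SimpleGraph (suc m)) (γ : Subgraph (suc m) → Subset (suc m) → Fin (suc m))
  (γ-choice : IsChoiceFunction G γ) (f : Fin (suc m) → ℕ∞) (f-parking : IsMultiparking G f) where
  open Algorithm G γ γ-choice f f-parking

  no-initial-edge : ∀ {u w} → Adj (F (initState f)) u w → False
  no-initial-edge {u} {w} h = ≡true⇒≢false (∈⇒lookup h)
    (trans (cong (λ r → lookup r w) (lookup∘tabulate (λ (_ : Fin (suc m)) → ⊥ {suc m}) u)) (lookup-⊥ w))

  nbrsIn-⊥ : ∀ w → nbrsIn ⊥ w ≡ 0
  nbrsIn-⊥ w = ∣a∩∁∁⊥∣≡0 (lookup (adj G) w)

  ∈∁⊥ : ∀ (x : Fin (suc m)) → x ∈ ∁ ⊥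
  ∈∁⊥ x = lookup-false⇒∈∁ {p = ⊥} (lookup-⊥ x)

  vertex-0-∞ : f zero ≡ ∞
  vertex-0-∞ with f-parking (∁ ⊥) (zero , ∈∁⊥ zero)
  ... | inj₁ (j , (_ , j-least) , fj) =
    subst (λ z → f z ≡ ∞) (Fin.≤-antisym (j-least zero (∈∁⊥ zero)) z≤n) fj
  ... | inj₂ (j , _ , k , _ , k<deg) = contradiction (subst (k <_) (nbrsIn-⊥ j) k<deg) ℕ.n≮0

  initial-invariant : Invariant 0 (initState f)
  initial-invariant = record
    { card-P = ∣⊥∣≡0 (suc m)
    ; subgraph = λ u w h → False-elim (no-initial-edge {u} {w} h)
    ; verts≡P∪Q = λ x → cong (_∨ lookup ⁅ zero ⁆ x) (sym (lookup-⊥ x))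
    ; ranking = record
      { rank = λ _ → 0 ; bound = 1 ; rank<bound = λ _ → s≤s z≤n
      ; rank-≢ = λ {x} {y} h → False-elim (no-initial-edge {x} {y} h)
      ; lower-unique = λ {a} {b} h → False-elim (no-initial-edge {a} {b} h) }
    ; root = λ x → x
    ; root-adj = λ {x} {y} h → False-elim (no-initial-edge {x} {y} h)
    ; reach-root = λ _ _ → here
    ; root-∞ = λ x e → subst (λ z → f z ≡ ∞) (sym (only-0 e)) vertex-0-∞
    ; root-≤ = λ _ _ → Fin.≤-refl
    ; ∞-is-root = λ _ _ _ → refl
    ; root-outside = λ _ _ → refl
    ; val-unprocessed = val-initial
    ; unqueued-parked = λ w _ _ _ _ → subst (ℕ._≤ _) (sym (nbrsIn-⊥ w)) z≤n
    ; active = λ _ → record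
      { treeRoot = zero
      ; treeRoot-least = λ _ _ → z≤n
      ; queue-admissible = inj₂ (zero , (x∈⁅x⁆ zero , isolated) , refl)
      ; queue-pending = λ w e → lookup-⊥ w , only-0 e , λ k fw →
          False-elim (∞≢just (trans (sym vertex-0-∞) (subst (λ z → f z ≡ just k) (only-0 e) fw))) } }
    where
      only-0 : ∀ {x} → lookup (verts (F (initState f))) x ≡ true → x ≡ zero
      only-0 e = eqB⇒≡ (trans (sym (lookup-⁅⁆ zero _)) e)

      isolated : degF (F (initState f)) zero ≡ 0
      isolated = trans (cong ∣_∣ (lookup∘tabulate (λ (_ : Fin (suc m)) → ⊥ {suc m}) zero))
                       (∣⊥∣≡0 (suc m))

      val-initial : ∀ w → lookup ⊥ w ≡ false → Maybe.map +_ (f w) ≡ Maybe.map (_⊖ nbrsIn ⊥ w) (f w)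
      val-initial w _ rewrite nbrsIn-⊥ w with f w
      ... | nothing = refl
      ... | just k  = refl

  final-state : State (suc m)
  final-state = iterate (suc m) (step G γ) (initState f)

  final-invariant : Invariant (suc m) final-state
  final-invariant = subst (λ j → Invariant j final-state) (ℕ.+-identityʳ (suc m))
    (iterate-invariant (suc m) (ℕ.≤-reflexive (ℕ.+-identityʳ (suc m))) initial-invariant)

  open Invariant final-invariant public

  spanning : ∀ z → lookup (verts (Φ G γ f)) z ≡ true
  spanning z = trans (verts≡P∪Q z) (cong (_∨ lookup (Q final-state) z) processed)
    where
      processed : lookup (P final-state) z ≡ true
      processed = ∈⇒lookup (subst (z ∈_) (sym (∣p∣≡n⇒p≡⊤ {p = P final-state} card-P)) ∈⊤)

proposition2p1 : ∀ {n} (G : SimpleGraph n) (γ : Subgraph n → Subset n → Fin n)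
    → IsChoiceFunction G γ
    → (f : Fin n → ℕ∞) → IsMultiparking G f
    → ∀ (x : Fin n)
    → ∃[ v ] (Reach (Φ G γ f) x v × f v ≡ ∞
              × (∀ y → Reach (Φ G γ f) x y → f y ≡ ∞ → y ≡ v)
              × (∀ y → Reach (Φ G γ f) x y → v ≤ y))
proposition2p1 {zero}  G γ γ-choice f f-parking ()
proposition2p1 {suc m} G γ γ-choice f f-parking x =
  root x , reach-root x (spanning x) , root-∞ x (spanning x) ,
  (λ y x⇝y fy → trans (sym (∞-is-root y (spanning y) fy)) (sym (same-root x⇝y))) ,
  (λ y x⇝y → subst (_≤ y) (sym (same-root x⇝y)) (root-≤ y (spanning y)))
  where
    open Run G γ γ-choice f f-parking
    same-root : ∀ {y} → Reach (Φ G γ f) x y → root x ≡ root y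
    same-root = Reach-preserves root root-adj
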